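{- Let $P(n)$ be any formula of the language (with only the free variable $n$) and let $m\prec n$ be a formula of the language defining a well-founded relation on the natural numbers. Then the transfinite induction sentence $\mathrm{TI}(P,\prec)$, namely $\forall n\,(\forall m\,(m\prec n\rightarrow P(m))\rightarrow P(n))\rightarrow \forall n\,P(n)$, is constructively true.
   Context: The language consists of first-order arithmetic (symbols $0,1,+,\cdot,<,=$, connectives $\neg,\wedge,\vee,\rightarrow$, quantifiers $\exists,\forall$ over natural numbers) together with a modal operator $\Box$, where $\Box A$ means "$A$ is constructively true". Witnesses (continuous function realizability) are sets of natural numbers defined by recursion on formulas with free variables assigned natural numbers: a witness for an atomic formula or for $\neg A$ exists iff the formula is true ($\neg A$ is true iff $A$ has no witness) and carries no information; for $A\wedge B$, witnesses for both; for $A\vee B$, a choice of disjunct plus a witness for it; for $\exists x\,A(x)$, a number $n$ and a witness for $A(n)$; for $\forall x\,A(x)$, on input $n$ a witness for $A(n)$; for $A\rightarrow B$, a real $W$ coding a continuous map (output determined by finite initial segments of input) such that for every witness $X$ of $A$ (arbitrary, not necessarily computable), $W_X$ is a witness for $B$; for $\Box A$, a code of a recursive witness for $A$. A sentence is constructively true iff it has a recursive witness. -}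

module Defs where

open import Data.Nat using (ℕ; zero; suc; _+_; _*_; _∸_; _^_; _<_; _≡ᵇ_)
open import Data.Bool using (Bool; true; false; if_then_else_)
open import Data.Fin using (Fin; zero; suc)
open import Data.Vec using (Vec; []; _∷_; lookup)
open import Data.Product using (Σ; _×_; _,_)
open import Data.Sum using (_⊎_)
open import Relation.Nullary using (¬_)
open import Relation.Binary.PropositionalEquality using (_≡_)
open import Induction.WellFounded using (WellFounded)

pair : ℕ → ℕ → ℕ
pair a b = (2 ^ a) * (2 * b + 1) ∸ 1

-- "sets of natural numbers" (reals) = characteristic functions
Real : Set
Real = ℕ → Bool

comp : Real → ℕ → Real
comp X i k = X (pair i k)

IsSingleton : Real → ℕ → Set
IsSingleton X n = ∀ k → X k ≡ (k ≡ᵇ n)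

-- code of the initial segment X↾l (bijective base-2 numeration)
initCode : Real → ℕ → ℕ
initCode X zero    = zero
initCode X (suc l) = suc (2 * initCode X l + (if X l then 1 else 0))

data PR : ℕ → Set where
  zer  : PR 0
  succ : PR 1
  proj : ∀ {n} → Fin n → PR n
  cmp  : ∀ {n m} → PR m → Vec (PR n) m → PR n
  prec : ∀ {n} → PR n → PR (suc (suc n)) → PR (suc n)
  mu   : ∀ {n} → PR (suc n) → PR n

mutual
  data Eval : ∀ {n} → PR n → Vec ℕ n → ℕ → Set where
    ev-zer   : Eval zer [] 0
    ev-succ  : ∀ {x} → Eval succ (x ∷ []) (suc x)
    ev-proj  : ∀ {n} {i : Fin n} {xs} → Eval (proj i) xs (lookup xs i)
    ev-cmp   : ∀ {n m} {f : PR m} {gs : Vec (PR n) m} {xs ys y} →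
               EvalVec gs xs ys → Eval f ys y → Eval (cmp f gs) xs y
    ev-prec0 : ∀ {n} {f : PR n} {g} {xs y} →
               Eval f xs y → Eval (prec f g) (0 ∷ xs) y
    ev-precS : ∀ {n} {f : PR n} {g} {k xs z y} →
               Eval (prec f g) (k ∷ xs) z → Eval g (k ∷ z ∷ xs) y →
               Eval (prec f g) (suc k ∷ xs) y
    ev-mu    : ∀ {n} {f : PR (suc n)} {xs y} →
               Eval f (y ∷ xs) 0 →
               (∀ z → z < y → Σ ℕ (λ w → Eval f (z ∷ xs) (suc w))) →
               Eval (mu f) xs y

  data EvalVec : ∀ {n m} → Vec (PR n) m → Vec ℕ n → Vec ℕ m → Set where
    evv-[] : ∀ {n} {xs : Vec ℕ n} → EvalVec [] xs []
    evv-∷  : ∀ {n m} {g : PR n} {gs : Vec (PR n) m} {xs y ys} →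
             Eval g xs y → EvalVec gs xs ys → EvalVec (g ∷ gs) xs (y ∷ ys)

mutual
  encode : ∀ {n} → PR n → ℕ
  encode zer             = pair 0 0
  encode succ            = pair 1 0
  encode (proj {n} i)    = pair 2 (pair n (Data.Fin.toℕ i))
  encode (cmp {n} {m} f gs) = pair 3 (pair n (pair m (pair (encode f) (encodeVec gs))))
  encode (prec {n} f g)  = pair 4 (pair n (pair (encode f) (encode g)))
  encode (mu {n} f)      = pair 5 (pair n (encode f))

  encodeVec : ∀ {n m} → Vec (PR n) m → ℕ
  encodeVec []       = 0
  encodeVec (g ∷ gs) = suc (pair (encode g) (encodeVec gs))

Computes : PR 1 → Real → Set
Computes p Z = ∀ k → Eval p (k ∷ []) (if Z k then 1 else 0)

-- Syntax: formulas with n free variables (de Bruijn, var zero = innermost)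

data Term (n : ℕ) : Set where
  var  : Fin n → Term n
  `0   : Term n
  `1   : Term n
  _`+_ : Term n → Term n → Term n
  _`·_ : Term n → Term n → Term n

data Fml (n : ℕ) : Set where
  _`<_ : Term n → Term n → Fml n
  _`=_ : Term n → Term n → Fml n
  `¬_  : Fml n → Fml n
  _`∧_ : Fml n → Fml n → Fml n
  _`∨_ : Fml n → Fml n → Fml n
  _`⇒_ : Fml n → Fml n → Fml n
  `∃   : Fml (suc n) → Fml n
  `∀   : Fml (suc n) → Fml n
  `□   : Fml n → Fml n

renT : ∀ {n m} → (Fin n → Fin m) → Term n → Term m
renT r (var i)  = var (r i)
renT r `0       = `0
renT r `1       = `1
renT r (s `+ t) = renT r s `+ renT r t
renT r (s `· t) = renT r s `· renT r t

lift : ∀ {n m} → (Fin n → Fin m) → Fin (suc n) → Fin (suc m)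
lift r zero    = zero
lift r (suc i) = suc (r i)

ren : ∀ {n m} → (Fin n → Fin m) → Fml n → Fml m
ren r (s `< t) = renT r s `< renT r t
ren r (s `= t) = renT r s `= renT r t
ren r (`¬ A)   = `¬ ren r A
ren r (A `∧ B) = ren r A `∧ ren r B
ren r (A `∨ B) = ren r A `∨ ren r B
ren r (A `⇒ B) = ren r A `⇒ ren r B
ren r (`∃ A)   = `∃ (ren (lift r) A)
ren r (`∀ A)   = `∀ (ren (lift r) A)
ren r (`□ A)   = `□ (ren r A)

evalT : ∀ {n} → Vec ℕ n → Term n → ℕ
evalT ρ (var i)  = lookup ρ i
evalT ρ `0       = 0
evalT ρ `1       = 1
evalT ρ (s `+ t) = evalT ρ s + evalT ρ t
evalT ρ (s `· t) = evalT ρ s * evalT ρ t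

-- W coded as a neighbourhood function: for output bit k and an initial
-- segment s, bit ⟨⟨k,s⟩,0⟩ of W says "defined", bit ⟨⟨k,s⟩,1⟩ the value.
-- W_X(k) is the value at the shortest initial segment of X that is flagged.
flagW : Real → ℕ → ℕ → Bool
flagW W k s = W (pair (pair k s) 0)

valW : Real → ℕ → ℕ → Bool
valW W k s = W (pair (pair k s) 1)

Apply : Real → Real → Real → Set
Apply W X Y = ∀ k → Σ ℕ λ l →
  (flagW W k (initCode X l) ≡ true) ×
  (∀ l' → l' < l → flagW W k (initCode X l') ≡ false) ×
  (valW W k (initCode X l) ≡ Y k)

Wit : ∀ {n} → Fml n → Vec ℕ n → Real → Set
Wit (s `< t) ρ X = evalT ρ s < evalT ρ t
Wit (s `= t) ρ X = evalT ρ s ≡ evalT ρ t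
Wit (`¬ A)   ρ X = ¬ (Σ Real λ Y → Wit A ρ Y)
Wit (A `∧ B) ρ X = Wit A ρ (comp X 0) × Wit B ρ (comp X 1)
Wit (A `∨ B) ρ X = ((comp X 0 0 ≡ false) × Wit A ρ (comp X 1))
                 ⊎ ((comp X 0 0 ≡ true)  × Wit B ρ (comp X 1))
Wit (A `⇒ B) ρ W = ∀ X → Wit A ρ X → Σ Real λ Y → Apply W X Y × Wit B ρ Y
Wit (`∃ A)   ρ X = Σ ℕ λ n → IsSingleton (comp X 0) n × Wit A (n ∷ ρ) (comp X 1)
Wit (`∀ A)   ρ X = ∀ n → Wit A (n ∷ ρ) (comp X n)
Wit (`□ A)   ρ X = Σ (PR 1) λ p → IsSingleton X (encode p) ×
                   Σ Real λ Z → Computes p Z × Wit A ρ Z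

ConstructivelyTrue : Fml 0 → Set
ConstructivelyTrue A = Σ (PR 1) λ p → Σ Real λ Z → Computes p Z × Wit A [] Z

-- Prec : Fml 2 with  var zero = m,  var (suc zero) = n  defines  m ≺ n
-- (truth of a formula = existence of a witness)
DefRel : Fml 2 → ℕ → ℕ → Set
DefRel Prec m n = Σ Real λ X → Wit Prec (m ∷ n ∷ []) X

TI : Fml 1 → Fml 2 → Fml 0
TI P Prec = `∀ (`∀ (Prec `⇒ ren embed P) `⇒ P) `⇒ `∀ P
  where
  embed : Fin 1 → Fin 2
  embed zero = zero

-- A realizer of TI(P, ≺) must turn any realizer X of progressiveness into realizers Yₙ of P(n).  Along ≺ one
-- would set Yₙ := Xₙ applied to V, where Vₘ codes the constant map with value Yₘ; this is circular, so V and
-- the bits of Y are computed together from X in stages.  At stage t each of the first t output bits that is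
-- still undecided is searched for by running the relevant neighbourhood code Xₙ on the part of V built so
-- far, consulting X only below t.  Vₘ raises its flag for output k exactly at the segment length s at which
-- bit k of Yₘ was decided, so every bit of V is fixed by a bounded stage and the construction is continuous
-- in X.  It does not mention ≺: well-foundedness only serves to show, by induction along ≺, that every bit
-- of Yₙ gets decided and that Yₙ realizes P(n).  The realizer of TI(P, ≺) is the primitive recursive
-- neighbourhood code of X ↦ Y that runs the simulation on finite initial segments of X.

module Submission where

open import Defs
open import Data.Bool using (Bool; true; false; if_then_else_)
open import Data.Empty using (⊥-elim)
open import Data.Fin using (Fin; zero; suc; #_; _↑ʳ_)
open import Data.Nat using (ℕ; zero; suc; _+_; _*_; _∸_; _^_; _<_; _≤_; _>_; pred; z≤n; s≤s; _⊓_)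
open import Data.Nat.Induction using (<-rec)
open import Data.Nat.Properties
open import Data.Product using (Σ; _×_; _,_; proj₁; proj₂; map₁; map₂)
open import Data.Sum using (_⊎_; inj₁; inj₂) renaming (map to ⊎-map)
open import Data.Vec using (Vec; []; _∷_; lookup; head; tail; map; tabulate; drop)
open import Data.Vec.N-ary using (N-ary; _$ⁿ_)
open import Data.Vec.Properties using (tabulate∘lookup)
open import Function.Bundles using (_⇔_; mk⇔; Equivalence)
open import Induction.WellFounded using (WellFounded; Acc; acc)
open import Relation.Binary.Definitions using (Tri; tri<; tri≈; tri>)
open import Relation.Binary.PropositionalEquality
open import Relation.Nullary using (yes; no)

open Equivalence using (to; from)

record Computable {n : ℕ} (f : Vec ℕ n → ℕ) : Set where
  constructor computable
  field
    program   : PR n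
    evaluates : ∀ xs → Eval program xs (f xs)
open Computable

infixr 5 _∷_
data Computables {n : ℕ} : ∀ {m} → Vec (Vec ℕ n → ℕ) m → Set where
  []  : Computables []
  _∷_ : ∀ {m f} {fs : Vec (Vec ℕ n → ℕ) m} → Computable f → Computables fs → Computables (f ∷ fs)

programs : ∀ {n m} {fs : Vec (Vec ℕ n → ℕ) m} → Computables fs → Vec (PR n) m
programs []       = []
programs (c ∷ cs) = program c ∷ programs cs

evaluatesAll : ∀ {n m} {fs : Vec (Vec ℕ n → ℕ) m} (cs : Computables fs) xs →
               EvalVec (programs cs) xs (map (λ f → f xs) fs)
evaluatesAll []       xs = evv-[]
evaluatesAll (c ∷ cs) xs = evv-∷ (evaluates c xs) (evaluatesAll cs xs)

computable-resp : ∀ {n} {f g : Vec ℕ n → ℕ} → f ≗ g → Computable f → Computable g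
computable-resp f≗g (computable p ev) = computable p (λ xs → subst (Eval p xs) (f≗g xs) (ev xs))

compose : ∀ {n m} {f : Vec ℕ m → ℕ} {gs : Vec (Vec ℕ n → ℕ) m} →
          Computable f → Computables gs → Computable (λ xs → f (map (λ g → g xs) gs))
compose c cs = computable (cmp (program c) (programs cs))
                          (λ xs → ev-cmp (evaluatesAll cs xs) (evaluates c _))

arg : ∀ {n} (i : Fin n) → Computable (λ xs → lookup xs i)
arg i = computable (proj i) (λ xs → ev-proj)

substitute : ∀ {n} m {f : Vec ℕ (suc n) → ℕ} {g : Vec ℕ (m + n) → ℕ} →
             Computable f → Computable g → Computable (λ xs → f (g xs ∷ drop m xs))
substitute m cf cg =
  computable (cmp (program cf) (program cg ∷ tabulate (λ i → proj (m ↑ʳ i))))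
             (λ xs → ev-cmp (evv-∷ (evaluates cg xs)
                                   (subst (EvalVec _ xs) (tabulate-lookup-↑ʳ m xs) (projections xs)))
                            (evaluates cf _))
  where
  projections : ∀ {n k} {ρ : Fin k → Fin n} xs →
                EvalVec (tabulate (λ i → proj (ρ i))) xs (tabulate (λ i → lookup xs (ρ i)))
  projections {k = zero}  xs = evv-[]
  projections {k = suc k} xs = evv-∷ ev-proj (projections xs)
  tabulate-lookup-↑ʳ : ∀ {n} m (xs : Vec ℕ (m + n)) → tabulate (λ i → lookup xs (m ↑ʳ i)) ≡ drop m xs
  tabulate-lookup-↑ʳ zero    xs       = tabulate∘lookup xs
  tabulate-lookup-↑ʳ (suc m) (x ∷ xs) = tabulate-lookup-↑ʳ m xs

recursion : ∀ {n} {f : Vec ℕ n → ℕ} {g : Vec ℕ (2 + n) → ℕ} (h : ℕ → Vec ℕ n → ℕ) →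
            Computable f → Computable g →
            (∀ xs → h 0 xs ≡ f xs) → (∀ j xs → h (suc j) xs ≡ g (j ∷ h j xs ∷ xs)) →
            Computable (λ xs → h (head xs) (tail xs))
recursion h (computable p evp) (computable q evq) base step = computable (prec p q) evaluation
  where
  evaluation : ∀ xs → Eval (prec p q) xs (h (head xs) (tail xs))
  evaluation (zero  ∷ xs) = subst (Eval _ _) (sym (base xs)) (ev-prec0 (evp xs))
  evaluation (suc j ∷ xs) = subst (Eval _ _) (sym (step j xs)) (ev-precS (evaluation (j ∷ xs)) (evq _))

-- h is an index, not just hidden inside Computable (h $ⁿ_), so that it can be inferred at use sites.
record Computableⁿ (n : ℕ) (h : N-ary n ℕ ℕ) : Set where
  constructor curried
  field
    uncurried : Computable (h $ⁿ_)
open Computableⁿ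

curry : ∀ {n} {f : Vec ℕ n → ℕ} (h : N-ary n ℕ ℕ) →
        Computable f → (∀ xs → f xs ≡ (h $ⁿ xs)) → Computableⁿ n h
curry h c f≗h = curried (computable-resp f≗h c)

recursionⁿ : ∀ {n} {f : Vec ℕ n → ℕ} {g : Vec ℕ (2 + n) → ℕ} (h : N-ary (suc n) ℕ ℕ) →
             Computable f → Computable g →
             (∀ xs → (h 0 $ⁿ xs) ≡ f xs) →
             (∀ j xs → (h (suc j) $ⁿ xs) ≡ g (j ∷ (h j $ⁿ xs) ∷ xs)) →
             Computableⁿ (suc n) h
recursionⁿ h cf cg base step =
  curry h (recursion (λ j xs → h j $ⁿ xs) cf cg base step) (λ { (x ∷ xs) → refl })

callⁿ : ∀ {n m} {h : N-ary m ℕ ℕ} {fs : Vec (Vec ℕ n → ℕ) m} →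
        Computableⁿ m h → Computables fs → Computable (λ xs → h $ⁿ map (λ f → f xs) fs)
callⁿ c cs = compose (uncurried c) cs

call₁ : ∀ {n h} {f : Vec ℕ n → ℕ} → Computableⁿ 1 h → Computable f → Computable (λ xs → h (f xs))
call₁ c a = callⁿ c (a ∷ [])

call₂ : ∀ {n h} {f g : Vec ℕ n → ℕ} → Computableⁿ 2 h → Computable f → Computable g →
        Computable (λ xs → h (f xs) (g xs))
call₂ c a b = callⁿ c (a ∷ b ∷ [])

call₃ : ∀ {n h} {f g k : Vec ℕ n → ℕ} → Computableⁿ 3 h →
        Computable f → Computable g → Computable k → Computable (λ xs → h (f xs) (g xs) (k xs))
call₃ c a b d = callⁿ c (a ∷ b ∷ d ∷ [])

suc-computable : Computableⁿ 1 suc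
suc-computable = curried (computable succ (λ { (x ∷ []) → ev-succ }))

lit : ∀ {n} (c : ℕ) → Computable {n} (λ _ → c)
lit zero    = callⁿ (curried (computable zer (λ { [] → ev-zer }))) []
lit (suc c) = call₁ suc-computable (lit c)

pred-computable : Computableⁿ 1 pred
pred-computable = recursionⁿ pred (lit 0) (arg (# 0)) (λ { [] → refl }) (λ { _ [] → refl })

+-computable : Computableⁿ 2 _+_
+-computable = recursionⁿ _+_ (arg (# 0)) (call₁ suc-computable (arg (# 1)))
  (λ { (b ∷ []) → refl }) (λ { _ (b ∷ []) → refl })

*-computable : Computableⁿ 2 _*_
*-computable = recursionⁿ _*_ (lit 0) (call₂ +-computable (arg (# 2)) (arg (# 1)))
  (λ { (b ∷ []) → refl }) (λ { _ (b ∷ []) → refl })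

∸-computable : Computableⁿ 2 _∸_
∸-computable = curry _∸_ (call₂ flipped (arg (# 1)) (arg (# 0))) (λ { (a ∷ b ∷ []) → refl })
  where
  flipped : Computableⁿ 2 (λ b a → a ∸ b)
  flipped = recursionⁿ (λ b a → a ∸ b) (arg (# 0)) (call₁ pred-computable (arg (# 1)))
    (λ { (a ∷ []) → refl }) (λ { b (a ∷ []) → sym (pred[m∸n]≡m∸[1+n] a b) })

2^-computable : Computableⁿ 1 (2 ^_)
2^-computable = recursionⁿ (2 ^_) (lit 1) (call₂ *-computable (lit 2) (arg (# 1)))
  (λ { [] → refl }) (λ { _ [] → refl })

if0 : ℕ → ℕ → ℕ → ℕ
if0 zero    a b = a
if0 (suc _) a b = b

if0-computable : Computableⁿ 3 if0
if0-computable = recursionⁿ if0 (arg (# 0)) (arg (# 3))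
  (λ { (a ∷ b ∷ []) → refl }) (λ { _ (a ∷ b ∷ []) → refl })

sum< : (ℕ → ℕ) → ℕ → ℕ
sum< f zero    = 0
sum< f (suc N) = sum< f N + f N

sum<-computable : ∀ {n} {F : Vec ℕ (suc n) → ℕ} → Computable F →
                  Computable (λ xs → sum< (λ a → F (a ∷ tail xs)) (head xs))
sum<-computable {F = F} c =
  recursion (λ N xs → sum< (λ a → F (a ∷ xs)) N) (lit 0)
            (call₂ +-computable (arg (# 1)) (substitute 2 c (arg (# 0))))
            (λ xs → refl) (λ j xs → refl)

χ≡ : ℕ → ℕ → ℕ
χ≡ a b = if0 ((a ∸ b) + (b ∸ a)) 1 0

χ≤ : ℕ → ℕ → ℕ
χ≤ a b = if0 (a ∸ b) 1 0

χ≡-computable : Computableⁿ 2 χ≡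
χ≡-computable = curry χ≡
  (call₃ if0-computable (call₂ +-computable (call₂ ∸-computable (arg (# 0)) (arg (# 1)))
                                            (call₂ ∸-computable (arg (# 1)) (arg (# 0))))
                        (lit 1) (lit 0))
  (λ { (a ∷ b ∷ []) → refl })

χ≤-computable : Computableⁿ 2 χ≤
χ≤-computable = curry χ≤ (call₃ if0-computable (call₂ ∸-computable (arg (# 0)) (arg (# 1))) (lit 1) (lit 0))
  (λ { (a ∷ b ∷ []) → refl })

χ≡-refl : ∀ a → χ≡ a a ≡ 1
χ≡-refl a rewrite n∸n≡0 a = refl

χ≡-≢ : ∀ {a b} → a ≢ b → χ≡ a b ≡ 0
χ≡-≢ {a} {b} a≢b with (a ∸ b) + (b ∸ a) in eq
... | suc _ = refl
... | zero  = ⊥-elim (a≢b (≤-antisym (m∸n≡0⇒m≤n (m+n≡0⇒m≡0 (a ∸ b) eq))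
                                     (m∸n≡0⇒m≤n (m+n≡0⇒n≡0 (a ∸ b) eq))))

χ≤-≤ : ∀ {a b} → a ≤ b → χ≤ a b ≡ 1
χ≤-≤ a≤b rewrite m≤n⇒m∸n≡0 a≤b = refl

χ≤-> : ∀ {a b} → a > b → χ≤ a b ≡ 0
χ≤-> {a} {b} a>b with a ∸ b in eq
... | suc _ = refl
... | zero  = ⊥-elim (<⇒≱ a>b (m∸n≡0⇒m≤n eq))

χ≤≡0⇒> : ∀ a b → χ≤ a b ≡ 0 → a > b
χ≤≡0⇒> a b eq with a ∸ b in a∸b
... | suc _ = m∸n≢0⇒n<m (λ a∸b≡0 → 0≢1+n (trans (sym a∸b≡0) a∸b))

suc-pair : ∀ a b → suc (pair a b) ≡ 2 ^ a * (2 * b + 1)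
suc-pair a b = trans (+-comm 1 (pair a b)) (m∸n+n≡m (*-mono-≤ (m^n>0 2 a) (m≤n+m 1 (2 * b))))

pair-zero : ∀ b → pair 0 b ≡ 2 * b
pair-zero b = trans (cong (_∸ 1) (*-identityˡ (2 * b + 1))) (m+n∸n≡m (2 * b) 1)

pair-suc : ∀ a b → pair (suc a) b ≡ suc (2 * pair a b)
pair-suc a b = begin
  2 * 2 ^ a * (2 * b + 1) ∸ 1   ≡⟨ cong (_∸ 1) (*-assoc 2 (2 ^ a) (2 * b + 1)) ⟩
  2 * (2 ^ a * (2 * b + 1)) ∸ 1 ≡⟨ cong (λ m → 2 * m ∸ 1) (sym (suc-pair a b)) ⟩
  2 * suc (pair a b) ∸ 1        ≡⟨ cong (_∸ 1) (*-suc 2 (pair a b)) ⟩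
  suc (2 * pair a b)            ∎
  where open ≡-Reasoning

pair-injective : ∀ {a b a′ b′} → pair a b ≡ pair a′ b′ → a ≡ a′ × b ≡ b′
pair-injective {zero} {b} {zero} {b′} eq =
  refl , *-cancelˡ-≡ b b′ 2 (trans (sym (pair-zero b)) (trans eq (pair-zero b′)))
pair-injective {zero} {b} {suc a′} {b′} eq =
  ⊥-elim (even≢odd b (pair a′ b′) (trans (sym (pair-zero b)) (trans eq (pair-suc a′ b′))))
pair-injective {suc a} {b} {zero} {b′} eq =
  ⊥-elim (even≢odd b′ (pair a b) (trans (sym (pair-zero b′)) (trans (sym eq) (pair-suc a b))))
pair-injective {suc a} {b} {suc a′} {b′} eq
  with pair-injective {a} {b} {a′} {b′}
         (*-cancelˡ-≡ _ _ 2 (suc-injective (trans (sym (pair-suc a b)) (trans eq (pair-suc a′ b′)))))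
... | refl , b≡b′ = refl , b≡b′

fst≤pair : ∀ a b → a ≤ pair a b
fst≤pair zero    b = z≤n
fst≤pair (suc a) b = subst (suc a ≤_) (sym (pair-suc a b)) (s≤s (≤-trans (fst≤pair a b) (m≤m+n _ _)))

snd≤pair : ∀ a b → b ≤ pair a b
snd≤pair zero    b = subst (b ≤_) (sym (pair-zero b)) (m≤m+n b (b + 0))
snd≤pair (suc a) b = subst (b ≤_) (sym (pair-suc a b)) (m≤n⇒m≤1+n (≤-trans (snd≤pair a b) (m≤m+n _ _)))

even-or-odd : ∀ c → Σ ℕ λ y → (c ≡ 2 * y) ⊎ (c ≡ suc (2 * y))
even-or-odd zero = 0 , inj₁ refl
even-or-odd (suc c) with even-or-odd c
... | y , inj₁ c≡2y = y , inj₂ (cong suc c≡2y)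
... | y , inj₂ c≡1+2y = suc y , inj₁ (trans (cong suc c≡1+2y) (sym (*-suc 2 y)))

pair-surjective : ∀ c → Σ ℕ λ a → Σ ℕ λ b → pair a b ≡ c
pair-surjective = <-rec _ preimage
  where
  preimage : ∀ c → (∀ {y} → y < c → Σ ℕ λ a → Σ ℕ λ b → pair a b ≡ y) →
             Σ ℕ λ a → Σ ℕ λ b → pair a b ≡ c
  preimage c rec with even-or-odd c
  ... | y , inj₁ refl = 0 , y , pair-zero y
  ... | y , inj₂ refl with rec (s≤s (m≤m+n y (y + 0)))
  ...   | a , b , refl = suc a , b , pair-suc a b

pair-computable : Computableⁿ 2 pair
pair-computable = curry pair
  (call₂ ∸-computable (call₂ *-computable (call₁ 2^-computable (arg (# 0)))
                                          (call₂ +-computable (call₂ *-computable (lit 2) (arg (# 1))) (lit 1)))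
                      (lit 1))
  (λ { (a ∷ b ∷ []) → refl })

sum<-zero : ∀ f N → (∀ a → a < N → f a ≡ 0) → sum< f N ≡ 0
sum<-zero f zero    f≡0 = refl
sum<-zero f (suc N) f≡0 = cong₂ _+_ (sum<-zero f N (λ a a<N → f≡0 a (m≤n⇒m≤1+n a<N))) (f≡0 N ≤-refl)

sum<-single : ∀ f N a₀ → a₀ < N → (∀ a → a < N → a ≢ a₀ → f a ≡ 0) → sum< f N ≡ f a₀
sum<-single f (suc N) a₀ a₀<1+N f≡0 with N ≟ a₀
... | yes refl = cong (_+ f N) (sum<-zero f N (λ a a<N → f≡0 a (m≤n⇒m≤1+n a<N) (<⇒≢ a<N)))
... | no N≢a₀ =
  trans (cong₂ _+_ (sum<-single f N a₀ (≤∧≢⇒< (≤-pred a₀<1+N) (≢-sym N≢a₀))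
                                 (λ a a<N → f≡0 a (m≤n⇒m≤1+n a<N)))
                   (f≡0 N ≤-refl N≢a₀))
        (+-identityʳ (f a₀))

sum<-≤ : ∀ f N → (∀ a → f a ≤ 1) → sum< f N ≤ N
sum<-≤ f zero    f≤1 = z≤n
sum<-≤ f (suc N) f≤1 = subst (sum< f N + f N ≤_) (+-comm N 1) (+-mono-≤ (sum<-≤ f N f≤1) (f≤1 N))

term≤sum< : ∀ f N a → a < N → f a ≤ sum< f N
term≤sum< f (suc N) a (s≤s a≤N) with m≤n⇒m<n∨m≡n a≤N
... | inj₁ a<N = ≤-trans (term≤sum< f N a a<N) (m≤m+n (sum< f N) (f N))
... | inj₂ refl = m≤n+m (f a) (sum< f N)

sum<-cong : ∀ {f g} N → (∀ a → f a ≡ g a) → sum< f N ≡ sum< g N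
sum<-cong zero    f≗g = refl
sum<-cong (suc N) f≗g = cong₂ _+_ (sum<-cong N f≗g) (f≗g N)

-- Inverting pair by bounded search keeps the inverse primitive recursive.
unpair : (ℕ → ℕ → ℕ) → ℕ → ℕ
unpair h c = sum< (λ a → sum< (λ b → χ≡ (pair a b) c * h a b) (suc c)) (suc c)

unpair-pair : ∀ h a b → unpair h (pair a b) ≡ h a b
unpair-pair h a b =
  trans (sum<-single _ (suc c) a (s≤s (fst≤pair a b)) other-row)
        (trans (sum<-single _ (suc c) b (s≤s (snd≤pair a b)) other-column)
               (trans (cong (_* h a b) (χ≡-refl c)) (*-identityˡ (h a b))))
  where
  c : ℕ
  c = pair a b
  other-column : ∀ b′ → b′ < suc c → b′ ≢ b → χ≡ (pair a b′) c * h a b′ ≡ 0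
  other-column b′ _ b′≢b = cong (_* h a b′)
    (χ≡-≢ {pair a b′} {c} (λ eq → b′≢b (proj₂ (pair-injective {a} {b′} {a} {b} eq))))
  other-row : ∀ a′ → a′ < suc c → a′ ≢ a →
              sum< (λ b′ → χ≡ (pair a′ b′) c * h a′ b′) (suc c) ≡ 0
  other-row a′ _ a′≢a = sum<-zero _ (suc c) (λ b′ _ → cong (_* h a′ b′)
    (χ≡-≢ {pair a′ b′} {c} (λ eq → a′≢a (proj₁ (pair-injective {a′} {b′} {a} {b} eq)))))

unpair-computable : ∀ {h} → Computableⁿ 2 h → Computableⁿ 1 (unpair h)
unpair-computable {h} h-computable = curry (unpair h)
  (compose (sum<-computable (compose (sum<-computable term)
                                     (call₁ suc-computable (arg (# 1)) ∷ arg (# 0) ∷ arg (# 1) ∷ [])))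
           (call₁ suc-computable (arg (# 0)) ∷ arg (# 0) ∷ []))
  (λ { (c ∷ []) → refl })
  where
  term : Computable (λ xs → χ≡ (pair (lookup xs (# 1)) (lookup xs (# 0))) (lookup xs (# 2))
                            * h (lookup xs (# 1)) (lookup xs (# 0)))
  term = call₂ *-computable (call₂ χ≡-computable (call₂ pair-computable (arg (# 1)) (arg (# 0))) (arg (# 2)))
                            (call₂ h-computable (arg (# 1)) (arg (# 0)))

-- Opaque: unfolding fst and snd into their defining double sums makes conversion checking explode.
opaque
  fst snd : ℕ → ℕ
  fst = unpair (λ a _ → a)
  snd = unpair (λ _ b → b)

  fst-computable : Computableⁿ 1 fst
  fst-computable = unpair-computable (curry (λ a _ → a) (arg (# 0)) (λ { (a ∷ b ∷ []) → refl }))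

  snd-computable : Computableⁿ 1 snd
  snd-computable = unpair-computable (curry (λ _ b → b) (arg (# 1)) (λ { (a ∷ b ∷ []) → refl }))

  fst-pair : ∀ a b → fst (pair a b) ≡ a
  fst-pair = unpair-pair (λ a _ → a)

  snd-pair : ∀ a b → snd (pair a b) ≡ b
  snd-pair = unpair-pair (λ _ b → b)

pair-fst-snd : ∀ c → pair (fst c) (snd c) ≡ c
pair-fst-snd c with pair-surjective c
... | a , b , refl = cong₂ pair (fst-pair a b) (snd-pair a b)

fst≤ : ∀ c → fst c ≤ c
fst≤ c with pair-surjective c
... | a , b , refl = subst (_≤ pair a b) (sym (fst-pair a b)) (fst≤pair a b)

snd≤ : ∀ c → snd c ≤ c
snd≤ c with pair-surjective c
... | a , b , refl = subst (_≤ pair a b) (sym (snd-pair a b)) (snd≤pair a b)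

toBit : Bool → ℕ
toBit b = if b then 1 else 0

nonZero : ℕ → Bool
nonZero zero    = false
nonZero (suc _) = true

sg : ℕ → ℕ
sg c = if0 c 0 1

toBit≤1 : ∀ b → toBit b ≤ 1
toBit≤1 true  = ≤-refl
toBit≤1 false = z≤n

nonZero-toBit : ∀ b → nonZero (toBit b) ≡ b
nonZero-toBit true  = refl
nonZero-toBit false = refl

toBit-nonZero : ∀ c → toBit (nonZero c) ≡ sg c
toBit-nonZero zero    = refl
toBit-nonZero (suc c) = refl

sg-computable : Computableⁿ 1 sg
sg-computable = curry sg (call₃ if0-computable (arg (# 0)) (lit 0) (lit 1)) (λ { (c ∷ []) → refl })

mod2 : ℕ → ℕ
mod2 zero    = 0
mod2 (suc c) = 1 ∸ mod2 c

div2 : ℕ → ℕ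
div2 zero    = 0
div2 (suc c) = div2 c + mod2 c

mod2-computable : Computableⁿ 1 mod2
mod2-computable = recursionⁿ mod2 (lit 0) (call₂ ∸-computable (lit 1) (arg (# 1)))
  (λ { [] → refl }) (λ { _ [] → refl })

div2-computable : Computableⁿ 1 div2
div2-computable = recursionⁿ div2 (lit 0) (call₂ +-computable (arg (# 1)) (call₁ mod2-computable (arg (# 0))))
  (λ { [] → refl }) (λ { _ [] → refl })

mod2≤1 : ∀ c → mod2 c ≤ 1
mod2≤1 zero    = z≤n
mod2≤1 (suc c) = m∸n≤m 1 (mod2 c)

mod2-[2+c] : ∀ c → mod2 (2 + c) ≡ mod2 c
mod2-[2+c] c = m∸[m∸n]≡n (mod2≤1 c)

div2-[2+c] : ∀ c → div2 (2 + c) ≡ suc (div2 c)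
div2-[2+c] c = trans (+-assoc (div2 c) (mod2 c) (1 ∸ mod2 c))
                     (trans (cong (div2 c +_) (m+[n∸m]≡n (mod2≤1 c))) (+-comm (div2 c) 1))

mod2-[2p+b] : ∀ p b → b ≤ 1 → mod2 (2 * p + b) ≡ b
mod2-[2p+b] zero    zero          _ = refl
mod2-[2p+b] zero    (suc zero)    _ = refl
mod2-[2p+b] zero    (suc (suc b)) (s≤s ())
mod2-[2p+b] (suc p) b b≤1 =
  trans (cong (λ m → mod2 (m + b)) (*-suc 2 p)) (trans (mod2-[2+c] (2 * p + b)) (mod2-[2p+b] p b b≤1))

div2-[2p+b] : ∀ p b → b ≤ 1 → div2 (2 * p + b) ≡ p
div2-[2p+b] zero    zero          _ = refl
div2-[2p+b] zero    (suc zero)    _ = refl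
div2-[2p+b] zero    (suc (suc b)) (s≤s ())
div2-[2p+b] (suc p) b b≤1 =
  trans (cong (λ m → div2 (m + b)) (*-suc 2 p)) (trans (div2-[2+c] (2 * p + b)) (cong suc (div2-[2p+b] p b b≤1)))

-- initCode X (l + 1) = 2 · initCode X l + 1 + X l, so dropLast undoes one step and codeLength counts steps.
dropLast : ℕ → ℕ
dropLast c = div2 (pred c)

dropLast^ : ℕ → ℕ → ℕ
dropLast^ zero    c = c
dropLast^ (suc e) c = dropLast (dropLast^ e c)

codeLength : ℕ → ℕ
codeLength c = sum< (λ e → sg (dropLast^ e c)) c

codeBit : ℕ → ℕ → ℕ
codeBit c i = mod2 (pred (dropLast^ (codeLength c ∸ suc i) c))

dropLast^-computable : Computableⁿ 2 dropLast^
dropLast^-computable =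
  recursionⁿ dropLast^ (arg (# 0)) (call₁ div2-computable (call₁ pred-computable (arg (# 1))))
  (λ { (c ∷ []) → refl }) (λ { _ (c ∷ []) → refl })

codeLength-computable : Computableⁿ 1 codeLength
codeLength-computable = curry codeLength
  (compose (sum<-computable (call₁ sg-computable (call₂ dropLast^-computable (arg (# 0)) (arg (# 1)))))
           (arg (# 0) ∷ arg (# 0) ∷ []))
  (λ { (c ∷ []) → refl })

codeBit-computable : Computableⁿ 2 codeBit
codeBit-computable = curry codeBit
  (call₁ mod2-computable (call₁ pred-computable
    (call₂ dropLast^-computable (call₂ ∸-computable (call₁ codeLength-computable (arg (# 0)))
                                                    (call₁ suc-computable (arg (# 1))))
                                (arg (# 0)))))
  (λ { (c ∷ i ∷ []) → refl })

codeLength≤ : ∀ c → codeLength c ≤ c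
codeLength≤ c = sum<-≤ _ c (λ e → sg≤1 (dropLast^ e c))
  where
  sg≤1 : ∀ m → sg m ≤ 1
  sg≤1 zero    = z≤n
  sg≤1 (suc m) = ≤-refl

sum<-sg[L∸e] : ∀ L N → sum< (λ e → sg (L ∸ e)) N ≡ N ⊓ L
sum<-sg[L∸e] L zero = refl
sum<-sg[L∸e] L (suc N) with L ∸ N in L∸N
... | zero  = trans (+-identityʳ _) (trans (sum<-sg[L∸e] L N)
                   (trans (m≥n⇒m⊓n≡n L≤N) (sym (m≥n⇒m⊓n≡n (m≤n⇒m≤1+n L≤N)))))
  where
  L≤N : L ≤ N
  L≤N = m∸n≡0⇒m≤n L∸N
... | suc _ = trans (+-comm _ 1) (trans (cong suc (trans (sum<-sg[L∸e] L N) (m≤n⇒m⊓n≡m (<⇒≤ N<L))))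
                                      (sym (m≤n⇒m⊓n≡m N<L)))
  where
  N<L : N < L
  N<L = m∸n≢0⇒n<m (λ L∸N≡0 → 0≢1+n (trans (sym L∸N≡0) L∸N))

module _ (X : Real) where
  initCode-≥ : ∀ L → L ≤ initCode X L
  initCode-≥ zero    = z≤n
  initCode-≥ (suc L) = s≤s (≤-trans (initCode-≥ L) (≤-trans (m≤m+n _ (initCode X L + 0)) (m≤m+n _ _)))

  dropLast-initCode : ∀ l → dropLast (initCode X (suc l)) ≡ initCode X l
  dropLast-initCode l = div2-[2p+b] (initCode X l) (toBit (X l)) (toBit≤1 (X l))

  dropLast^-initCode : ∀ e L → dropLast^ e (initCode X L) ≡ initCode X (L ∸ e)
  dropLast^-initCode zero    L = refl
  dropLast^-initCode (suc e) L rewrite dropLast^-initCode e L | sym (pred[m∸n]≡m∸[1+n] L e) with L ∸ e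
  ... | zero  = refl
  ... | suc l = dropLast-initCode l

  sg-initCode : ∀ L → sg (initCode X L) ≡ sg L
  sg-initCode zero    = refl
  sg-initCode (suc L) = refl

  codeLength-initCode : ∀ L → codeLength (initCode X L) ≡ L
  codeLength-initCode L = begin
    sum< (λ e → sg (dropLast^ e (initCode X L))) (initCode X L)
      ≡⟨ sum<-cong (initCode X L) (λ e → trans (cong sg (dropLast^-initCode e L)) (sg-initCode (L ∸ e))) ⟩
    sum< (λ e → sg (L ∸ e)) (initCode X L)
      ≡⟨ sum<-sg[L∸e] L (initCode X L) ⟩
    initCode X L ⊓ L
      ≡⟨ m≥n⇒m⊓n≡n (initCode-≥ L) ⟩
    L ∎
    where open ≡-Reasoning

  codeBit-initCode : ∀ L i → i < L → codeBit (initCode X L) i ≡ toBit (X i)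
  codeBit-initCode L i i<L rewrite codeLength-initCode L | dropLast^-initCode (L ∸ suc i) L | m∸[m∸n]≡n i<L =
    mod2-[2p+b] (initCode X i) (toBit (X i)) (toBit≤1 (X i))

-- A table [e₀, …, eₖ] is coded as pair e₀ (… (pair eₖ 0)); entries past the end read as 0.
drop^ : ℕ → ℕ → ℕ
drop^ zero    l = l
drop^ (suc q) l = snd (drop^ q l)

entry : ℕ → ℕ → ℕ
entry l q = fst (drop^ q l)

-- tabulateFrom t f r codes [f (t ∸ r), …, f (t ∸ 1)], built from the back to be a primitive recursion in r.
tabulateFrom : ℕ → (ℕ → ℕ) → ℕ → ℕ
tabulateFrom t f zero    = 0
tabulateFrom t f (suc r) = pair (f (t ∸ suc r)) (tabulateFrom t f r)

tabulateᶜ : ℕ → (ℕ → ℕ) → ℕ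
tabulateᶜ t f = tabulateFrom t f t

entry-computable : Computableⁿ 2 entry
entry-computable = curry entry (call₁ fst-computable (call₂ drop^-computable (arg (# 1)) (arg (# 0))))
  (λ { (l ∷ q ∷ []) → refl })
  where
  drop^-computable : Computableⁿ 2 drop^
  drop^-computable = recursionⁿ drop^ (arg (# 0)) (call₁ snd-computable (arg (# 1)))
    (λ { (l ∷ []) → refl }) (λ { _ (l ∷ []) → refl })

tabulateᶜ-computable : ∀ {n} {F : Vec ℕ (suc n) → ℕ} → Computable F →
                       Computable (λ xs → tabulateᶜ (head xs) (λ q → F (q ∷ tail xs)))
tabulateᶜ-computable {F = F} c =
  computable-resp (λ { (t ∷ xs) → refl }) (substitute 0 tabulateFrom-computable (arg (# 0)))
  where
  tabulateFrom-computable :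
    Computable (λ xs → tabulateFrom (head (tail xs)) (λ q → F (q ∷ tail (tail xs))) (head xs))
  tabulateFrom-computable =
    recursion (λ r xs → tabulateFrom (head xs) (λ q → F (q ∷ tail xs)) r) (lit 0)
              (call₂ pair-computable
                     (substitute 3 c (call₂ ∸-computable (arg (# 2)) (call₁ suc-computable (arg (# 0)))))
                     (arg (# 1)))
              (λ xs → refl) (λ { j (t ∷ xs) → refl })

drop^-suc : ∀ q l → drop^ (suc q) l ≡ drop^ q (snd l)
drop^-suc zero    l = refl
drop^-suc (suc q) l = cong snd (drop^-suc q l)

entry-empty : ∀ q → entry 0 q ≡ 0
entry-empty q = trans (cong fst (drop^-empty q)) (fst-pair 0 0)
  where
  drop^-empty : ∀ q → drop^ q 0 ≡ 0
  drop^-empty zero    = refl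
  drop^-empty (suc q) = trans (cong snd (drop^-empty q)) (snd-pair 0 0)

entry-pair-zero : ∀ e l → entry (pair e l) 0 ≡ e
entry-pair-zero = fst-pair

entry-pair-suc : ∀ e l q → entry (pair e l) (suc q) ≡ entry l q
entry-pair-suc e l q = cong fst (trans (drop^-suc q (pair e l)) (cong (drop^ q) (snd-pair e l)))

entry-tabulateFrom : ∀ t f r q → r ≤ t → q < r → entry (tabulateFrom t f r) q ≡ f (t ∸ r + q)
entry-tabulateFrom t f (suc r) zero    r≤t q<r =
  trans (entry-pair-zero (f (t ∸ suc r)) (tabulateFrom t f r)) (cong f (sym (+-identityʳ _)))
entry-tabulateFrom t f (suc r) (suc q) r≤t (s≤s q<r) =
  trans (entry-pair-suc (f (t ∸ suc r)) (tabulateFrom t f r) q)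
        (trans (entry-tabulateFrom t f r q (≤-trans (n≤1+n r) r≤t) q<r)
               (cong f (trans (cong (_+ q) (+-∸-assoc 1 r≤t)) (sym (+-suc (t ∸ suc r) q)))))

entry-tabulateFrom-≥ : ∀ t f r q → r ≤ q → entry (tabulateFrom t f r) q ≡ 0
entry-tabulateFrom-≥ t f zero    q       _         = entry-empty q
entry-tabulateFrom-≥ t f (suc r) (suc q) (s≤s r≤q) =
  trans (entry-pair-suc (f (t ∸ suc r)) (tabulateFrom t f r) q) (entry-tabulateFrom-≥ t f r q r≤q)

entry-tabulateᶜ : ∀ t f q → q < t → entry (tabulateᶜ t f) q ≡ f q
entry-tabulateᶜ t f q q<t = trans (entry-tabulateFrom t f t q ≤-refl q<t) (cong (λ m → f (m + q)) (n∸n≡0 t))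

entry-tabulateᶜ-≥ : ∀ t f q → t ≤ q → entry (tabulateᶜ t f) q ≡ 0
entry-tabulateᶜ-≥ t f = entry-tabulateFrom-≥ t f t

tabulateᶜ-cong : ∀ t {f g} → (∀ q → f q ≡ g q) → tabulateᶜ t f ≡ tabulateᶜ t g
tabulateᶜ-cong t {f} {g} f≗g = tabulateFrom-cong t
  where
  tabulateFrom-cong : ∀ r → tabulateFrom t f r ≡ tabulateFrom t g r
  tabulateFrom-cong zero    = refl
  tabulateFrom-cong (suc r) = cong₂ pair (f≗g _) (tabulateFrom-cong r)

firstNonZero : (ℕ → ℕ) → ℕ → ℕ
firstNonZero f zero    = 0
firstNonZero f (suc l) = if0 (firstNonZero f l) (f l) (firstNonZero f l)

firstNonZero-computable : ∀ {n} {F : Vec ℕ (suc n) → ℕ} → Computable F →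
                          Computable (λ xs → firstNonZero (λ l → F (l ∷ tail xs)) (head xs))
firstNonZero-computable {F = F} c =
  recursion (λ N xs → firstNonZero (λ l → F (l ∷ xs)) N) (lit 0)
            (call₃ if0-computable (arg (# 1)) (substitute 2 c (arg (# 0))) (arg (# 1)))
            (λ xs → refl) (λ j xs → refl)

module _ {f : ℕ → ℕ} where
  firstNonZero-≡0 : ∀ N → firstNonZero f N ≡ 0 → ∀ l → l < N → f l ≡ 0
  firstNonZero-≡0 (suc N) eq l (s≤s l≤N) with firstNonZero f N in first
  ... | suc _ = ⊥-elim (0≢1+n (sym eq))
  ... | zero with m≤n⇒m<n∨m≡n l≤N
  ...   | inj₁ l<N  = firstNonZero-≡0 N first l l<N
  ...   | inj₂ refl = eq

  firstNonZero-zeros : ∀ N → (∀ l → l < N → f l ≡ 0) → firstNonZero f N ≡ 0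
  firstNonZero-zeros zero    zeros = refl
  firstNonZero-zeros (suc N) zeros
    rewrite firstNonZero-zeros N (λ l l<N → zeros l (m≤n⇒m≤1+n l<N)) = zeros N ≤-refl

  firstNonZero-≡suc : ∀ N w → firstNonZero f N ≡ suc w →
                      Σ ℕ λ l → l < N × (∀ l′ → l′ < l → f l′ ≡ 0) × f l ≡ suc w
  firstNonZero-≡suc (suc N) w eq with firstNonZero f N in first
  ... | zero = N , ≤-refl , firstNonZero-≡0 N first , eq
  ... | suc _ with firstNonZero-≡suc N w (trans first eq)
  ...   | l , l<N , zeros , hit = l , m≤n⇒m≤1+n l<N , zeros , hit

  firstNonZero-at : ∀ N l w → l < N → (∀ l′ → l′ < l → f l′ ≡ 0) → f l ≡ suc w →
                    firstNonZero f N ≡ suc w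
  firstNonZero-at (suc N) l w (s≤s l≤N) zeros hit with m≤n⇒m<n∨m≡n l≤N
  ... | inj₁ l<N rewrite firstNonZero-at N l w l<N zeros hit = refl
  ... | inj₂ refl rewrite firstNonZero-zeros l zeros = hit

firstNonZero-cong : ∀ {f g} N → (∀ l → f l ≡ g l) → firstNonZero f N ≡ firstNonZero g N
firstNonZero-cong zero    f≗g = refl
firstNonZero-cong (suc N) f≗g rewrite firstNonZero-cong N f≗g | f≗g N = refl

-- The staged simulation

-- The oracle x is consulted only below t: 0 = flag off, 1 = give up, 2 + w = value w found.
probe : (ℕ → ℕ) → ℕ → ℕ → ℕ → ℕ
probe x t f v = if0 (χ≤ t f) (if0 (x f) 0 (if0 (χ≤ t v) (2 + x v) 1)) 1

module _ (x : ℕ → ℕ) (t f v : ℕ) where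
  probe-≡0 : probe x t f v ≡ 0 → f < t × x f ≡ 0
  probe-≡0 eq with χ≤ t f in t≤f
  ... | suc _ = ⊥-elim (0≢1+n (sym eq))
  ... | zero with x f
  ...   | zero = χ≤≡0⇒> t f t≤f , refl
  ...   | suc _ with χ≤ t v
  ...     | zero  = ⊥-elim (0≢1+n (sym eq))
  ...     | suc _ = ⊥-elim (0≢1+n (sym eq))

  probe-≡2+ : ∀ w → probe x t f v ≡ 2 + w → f < t × x f ≢ 0 × w ≡ x v
  probe-≡2+ w eq with χ≤ t f in t≤f
  ... | suc _ = ⊥-elim (0≢1+n (suc-injective eq))
  ... | zero with x f
  ...   | zero = ⊥-elim (0≢1+n eq)
  ...   | suc _ with χ≤ t v
  ...     | zero  = χ≤≡0⇒> t f t≤f , (λ ()) , sym (suc-injective (suc-injective eq))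
  ...     | suc _ = ⊥-elim (0≢1+n (suc-injective eq))

  probe-skip : f < t → x f ≡ 0 → probe x t f v ≡ 0
  probe-skip f<t xf≡0 rewrite χ≤-> f<t | xf≡0 = refl

  probe-hit : f < t → x f ≡ 1 → v < t → probe x t f v ≡ 2 + x v
  probe-hit f<t xf≡1 v<t rewrite χ≤-> f<t | xf≡1 | χ≤-> v<t = refl

probe-cong : ∀ {x x′} t f v → (∀ r → r < t → x r ≡ x′ r) → probe x t f v ≡ probe x′ t f v
probe-cong {x} {x′} t f v x≈x′ with χ≤ t f in t≤f
... | suc _ = refl
... | zero rewrite x≈x′ f (χ≤≡0⇒> t f t≤f) with x′ f
...   | zero  = refl
...   | suc _ with χ≤ t v in t≤v
...     | suc _ = refl
...     | zero rewrite x≈x′ v (χ≤≡0⇒> t v t≤v) = refl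

codeIndex : ℕ → ℕ → ℕ → ℕ → ℕ
codeIndex n k σ b = pair n (pair (pair k σ) b)

-- A table entry is 0 (undecided) or suc (pair s v) (decided at stage s with value v).  Read as a
-- neighbourhood code, the output is flagged exactly at segments of length s and has value v from then on.
entryBit : ℕ → ℕ → ℕ → ℕ
entryBit e L b = if0 e 0 (if0 b (χ≡ (fst (pred e)) L) (if0 (pred b) (χ≤ (fst (pred e)) L * snd (pred e)) 0))

simulatedBit : ℕ → ℕ → ℕ
simulatedBit S i =
  entryBit (entry S (pair (fst i) (fst (fst (snd i))))) (codeLength (snd (fst (snd i)))) (snd (snd i))

segmentCode : ℕ → ℕ → ℕ
segmentCode S zero    = 0
segmentCode S (suc l) = suc (2 * segmentCode S l + sg (simulatedBit S l))

search : (ℕ → ℕ) → ℕ → ℕ → ℕ → ℕ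
search x t S q = firstNonZero (λ l → probe x t (codeIndex (fst q) (snd q) (segmentCode S l) 0)
                                                (codeIndex (fst q) (snd q) (segmentCode S l) 1)) t

entryFromSearch : ℕ → ℕ → ℕ
entryFromSearch r t = if0 r 0 (if0 (pred r) 0 (suc (pair (suc t) (pred (pred r)))))

nextEntry : (ℕ → ℕ) → ℕ → ℕ → ℕ → ℕ
nextEntry x t S q = if0 (entry S q) (entryFromSearch (search x t S q) t) (entry S q)

table : (ℕ → ℕ) → ℕ → ℕ
table x zero    = 0
table x (suc t) = tabulateᶜ (suc t) (nextEntry x t (table x t))

tableEntry : (ℕ → ℕ) → ℕ → ℕ → ℕ
tableEntry x t q = entry (table x t) q

search-cong : ∀ {x x′} t S q → (∀ r → r < t → x r ≡ x′ r) → search x t S q ≡ search x′ t S q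
search-cong t S q x≈x′ = firstNonZero-cong t (λ l →
  probe-cong t (codeIndex (fst q) (snd q) (segmentCode S l) 0) (codeIndex (fst q) (snd q) (segmentCode S l) 1)
             x≈x′)

table-cong : ∀ {x x′} t → (∀ r → r < t → x r ≡ x′ r) → table x t ≡ table x′ t
table-cong zero    x≈x′ = refl
table-cong {x} {x′} (suc t) x≈x′ rewrite table-cong t (λ r r<t → x≈x′ r (m≤n⇒m≤1+n r<t)) =
  tabulateᶜ-cong (suc t) (λ q → cong (λ r → if0 (entry S q) (entryFromSearch r t) (entry S q))
                                     (search-cong t S q (λ r r<t → x≈x′ r (m≤n⇒m≤1+n r<t))))
  where
  S : ℕ
  S = table x′ t

nextEntry-≡suc : ∀ x t S q e → nextEntry x t S q ≡ suc e →
  (entry S q ≡ suc e) ⊎ (entry S q ≡ 0 × Σ ℕ λ w → search x t S q ≡ 2 + w × e ≡ pair (suc t) w)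
nextEntry-≡suc x t S q e eq with entry S q
... | suc _ = inj₁ eq
... | zero with search x t S q
...   | suc (suc w) = inj₂ (refl , w , refl , sym (suc-injective eq))

module _ (x : ℕ → ℕ) where
  tableEntry-≥ : ∀ t q → t ≤ q → tableEntry x t q ≡ 0
  tableEntry-≥ zero    q _   = entry-empty q
  tableEntry-≥ (suc t) q t≤q = entry-tabulateᶜ-≥ (suc t) (nextEntry x t (table x t)) q t≤q

  tableEntry-suc : ∀ t q → q < suc t → tableEntry x (suc t) q ≡ nextEntry x t (table x t) q
  tableEntry-suc t q = entry-tabulateᶜ (suc t) (nextEntry x t (table x t)) q

  tableEntry-< : ∀ t q e → tableEntry x t q ≡ suc e → q < t
  tableEntry-< t q e eq with q <? t
  ... | yes q<t = q<t
  ... | no q≮t  = ⊥-elim (0≢1+n (trans (sym (tableEntry-≥ t q (≮⇒≥ q≮t))) eq))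

  tableEntry-step : ∀ t q e → tableEntry x t q ≡ suc e → tableEntry x (suc t) q ≡ suc e
  tableEntry-step t q e eq rewrite tableEntry-suc t q (m≤n⇒m≤1+n (tableEntry-< t q e eq)) | eq = refl

  tableEntry-mono : ∀ {t t′} q e → t ≤ t′ → tableEntry x t q ≡ suc e → tableEntry x t′ q ≡ suc e
  tableEntry-mono {t} {t′} q e t≤t′ eq with m≤n⇒m<n∨m≡n t≤t′
  ... | inj₂ refl = eq
  tableEntry-mono {t} {suc t′} q e _ eq | inj₁ (s≤s t≤t′) =
    tableEntry-step t′ q e (tableEntry-mono q e t≤t′ eq)

  tableEntry-unique : ∀ u u′ q e e′ →
                      tableEntry x u q ≡ suc e → tableEntry x u′ q ≡ suc e′ → e ≡ e′
  tableEntry-unique u u′ q e e′ eq eq′ with ≤-total u u′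
  ... | inj₁ u≤u′ = suc-injective (trans (sym (tableEntry-mono q e u≤u′ eq)) eq′)
  ... | inj₂ u′≤u = suc-injective (trans (sym eq) (tableEntry-mono q e′ u′≤u eq′))

  record Origin (t q e : ℕ) : Set where
    field
      stage    : ℕ
      before   : stage < t
      value    : ℕ
      encoded  : e ≡ pair (suc stage) value
      found    : search x stage (table x stage) q ≡ 2 + value
      recorded : tableEntry x (suc stage) q ≡ suc e

  tableEntry-origin : ∀ t q e → tableEntry x t q ≡ suc e → Origin t q e
  tableEntry-origin zero    q e eq = ⊥-elim (0≢1+n (trans (sym (entry-empty q)) eq))
  tableEntry-origin (suc t) q e eq =
    from-step (nextEntry-≡suc x t (table x t) q e
                 (trans (sym (tableEntry-suc t q (tableEntry-< (suc t) q e eq))) eq))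
    where
    from-step : (tableEntry x t q ≡ suc e) ⊎
                (tableEntry x t q ≡ 0 ×
                 Σ ℕ λ w → search x t (table x t) q ≡ 2 + w × e ≡ pair (suc t) w) →
                Origin (suc t) q e
    from-step (inj₂ (_ , w , found , encoded)) = record
      { stage = t ; before = ≤-refl ; value = w ; encoded = encoded ; found = found ; recorded = eq }
    from-step (inj₁ earlier) = record
      { stage = stage ; before = m≤n⇒m≤1+n before ; value = value
      ; encoded = encoded ; found = found ; recorded = recorded }
      where open Origin (tableEntry-origin t q e earlier)

  tableEntry-stage : ∀ u q s w → tableEntry x u q ≡ suc (pair s w) →
                     s ≤ u × tableEntry x s q ≡ suc (pair s w)
  tableEntry-stage u q s w eq =
    subst (_≤ u) (sym s≡) before , subst (λ s′ → tableEntry x s′ q ≡ suc (pair s w)) (sym s≡) recorded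
    where
    open Origin (tableEntry-origin u q (pair s w) eq)
    s≡ : s ≡ suc stage
    s≡ = proj₁ (pair-injective {s} {w} {suc stage} {value} encoded)

  tableEntry-settled : ∀ u q s v → tableEntry x s q ≡ suc (pair s v) →
                       tableEntry x u q ≡ 0 ⊎ tableEntry x u q ≡ suc (pair s v)
  tableEntry-settled u q s v at with tableEntry x u q in eq
  ... | zero  = inj₁ refl
  ... | suc e = inj₂ (cong suc (tableEntry-unique u s q e (pair s v) eq at))

entryBit-flag : ∀ s v → entryBit (suc (pair s v)) s 0 ≡ 1
entryBit-flag s v = trans (cong (λ s′ → χ≡ s′ s) (fst-pair s v)) (χ≡-refl s)

entryBit-value : ∀ s v → entryBit (suc (pair s v)) s 1 ≡ v
entryBit-value s v = trans (cong₂ (λ s′ v′ → χ≤ s′ s * v′) (fst-pair s v) (snd-pair s v))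
                           (trans (cong (_* v) (χ≤-≤ (≤-refl {s}))) (+-identityʳ v))

entryBit-unflagged : ∀ s v L → L ≢ s → entryBit (suc (pair s v)) L 0 ≡ 0
entryBit-unflagged s v L L≢s = trans (cong (λ s′ → χ≡ s′ L) (fst-pair s v)) (χ≡-≢ (≢-sym L≢s))

entryBit-early : ∀ s v L b → L < s → entryBit (suc (pair s v)) L b ≡ 0
entryBit-early s v L zero          L<s = entryBit-unflagged s v L (<⇒≢ L<s)
entryBit-early s v L (suc zero)    L<s = trans (cong (λ s′ → χ≤ s′ L * snd (pair s v)) (fst-pair s v))
                                               (cong (_* snd (pair s v)) (χ≤-> L<s))
entryBit-early s v L (suc (suc b)) L<s = refl

simulatedBit-codeIndex : ∀ S m k σ b →
                         simulatedBit S (codeIndex m k σ b) ≡ entryBit (entry S (pair m k)) (codeLength σ) b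
simulatedBit-codeIndex S m k σ b =
  cong (λ { ((m′ , k′) , (σ′ , b′)) → entryBit (entry S (pair m′ k′)) (codeLength σ′) b′ })
       (cong₂ _,_ (cong₂ _,_ (fst-pair m r) k≡) (cong₂ _,_ σ≡ b≡))
  where
  r : ℕ
  r = pair (pair k σ) b
  kσ≡ : fst (snd (codeIndex m k σ b)) ≡ pair k σ
  kσ≡ = trans (cong fst (snd-pair m r)) (fst-pair (pair k σ) b)
  k≡ : fst (fst (snd (codeIndex m k σ b))) ≡ k
  k≡ = trans (cong fst kσ≡) (fst-pair k σ)
  σ≡ : snd (fst (snd (codeIndex m k σ b))) ≡ σ
  σ≡ = trans (cong snd kσ≡) (snd-pair k σ)
  b≡ : snd (snd (codeIndex m k σ b)) ≡ b
  b≡ = trans (cong snd (snd-pair m r)) (snd-pair (pair k σ) b)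

simulatedV : (ℕ → ℕ) → Real
simulatedV x i = nonZero (simulatedBit (table x (suc i)) i)

module _ (x : ℕ → ℕ) where
  undecided-before : ∀ u u′ q s w → tableEntry x u q ≡ 0 → tableEntry x u′ q ≡ suc (pair s w) → u < s
  undecided-before u u′ q s w undecided decided with s ≤? u
  ... | no s≰u  = ≰⇒> s≰u
  ... | yes s≤u = ⊥-elim (0≢1+n (trans (sym undecided)
                    (tableEntry-mono x q (pair s w) s≤u (proj₂ (tableEntry-stage x u′ q s w decided)))))

  -- An entry decided after stage u is flagged only at lengths beyond u, so bits at lengths below u never change.
  entryBit-stable : ∀ L u u′ q b → L < u → u ≤ u′ →
                    entryBit (tableEntry x u q) L b ≡ entryBit (tableEntry x u′ q) L b
  entryBit-stable L u u′ q b L<u u≤u′ with tableEntry x u q in eq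
  ... | suc e rewrite tableEntry-mono x q e u≤u′ eq = refl
  ... | zero with tableEntry x u′ q in eq′
  ...   | zero   = refl
  ...   | suc e′ with pair-surjective e′
  ...     | s , w , refl = sym (entryBit-early s w L b (<-trans L<u (undecided-before u u′ q s w eq eq′)))

  simulatedBit-stable : ∀ t i → i < t → simulatedBit (table x t) i ≡ simulatedBit (table x (suc i)) i
  simulatedBit-stable t i i<t =
    sym (entryBit-stable (codeLength σ) (suc i) t (pair (fst i) (fst (fst (snd i)))) (snd (snd i)) (s≤s σ≤i) i<t)
    where
    σ : ℕ
    σ = snd (fst (snd i))
    σ≤i : codeLength σ ≤ i
    σ≤i = ≤-trans (codeLength≤ σ) (≤-trans (snd≤ _) (≤-trans (fst≤ _) (snd≤ i)))

  segmentCode-table : ∀ t l → l ≤ t → segmentCode (table x t) l ≡ initCode (simulatedV x) l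
  segmentCode-table t zero    _   = refl
  segmentCode-table t (suc l) l<t = cong suc (cong₂ _+_ (cong (2 *_) (segmentCode-table t l (<⇒≤ l<t)))
    (trans (cong sg (simulatedBit-stable t l l<t)) (sym (toBit-nonZero (simulatedBit (table x (suc l)) l)))))

codeIndex-computable : Computableⁿ 4 codeIndex
codeIndex-computable = curry codeIndex
  (call₂ pair-computable (arg (# 0))
                         (call₂ pair-computable (call₂ pair-computable (arg (# 1)) (arg (# 2))) (arg (# 3))))
  (λ { (n ∷ k ∷ σ ∷ b ∷ []) → refl })

entryBit-computable : Computableⁿ 3 entryBit
entryBit-computable = curry entryBit
  (call₃ if0-computable (arg (# 0)) (lit 0)
    (call₃ if0-computable (arg (# 2)) (call₂ χ≡-computable stage (arg (# 1)))
      (call₃ if0-computable (call₁ pred-computable (arg (# 2)))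
        (call₂ *-computable (call₂ χ≤-computable stage (arg (# 1)))
                            (call₁ snd-computable (call₁ pred-computable (arg (# 0)))))
        (lit 0))))
  (λ { (e ∷ L ∷ b ∷ []) → refl })
  where
  stage : Computable {3} (λ xs → fst (pred (lookup xs (# 0))))
  stage = call₁ fst-computable (call₁ pred-computable (arg (# 0)))

simulatedBit-computable : Computableⁿ 2 simulatedBit
simulatedBit-computable = curry simulatedBit
  (call₃ entryBit-computable
    (call₂ entry-computable (arg (# 0))
                            (call₂ pair-computable (call₁ fst-computable (arg (# 1)))
                                                   (call₁ fst-computable (call₁ fst-computable rest))))
    (call₁ codeLength-computable (call₁ snd-computable (call₁ fst-computable rest)))
    (call₁ snd-computable rest))
  (λ { (S ∷ i ∷ []) → refl })
  where
  rest : Computable {2} (λ xs → snd (lookup xs (# 1)))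
  rest = call₁ snd-computable (arg (# 1))

segmentCode-computable : Computableⁿ 2 segmentCode
segmentCode-computable = curry segmentCode (call₂ flipped (arg (# 1)) (arg (# 0))) (λ { (S ∷ l ∷ []) → refl })
  where
  flipped : Computableⁿ 2 (λ l S → segmentCode S l)
  flipped = recursionⁿ (λ l S → segmentCode S l) (lit 0)
    (call₁ suc-computable (call₂ +-computable (call₂ *-computable (lit 2) (arg (# 1)))
                                              (call₁ sg-computable
                                                (call₂ simulatedBit-computable (arg (# 2)) (arg (# 0))))))
    (λ { (S ∷ []) → refl }) (λ { _ (S ∷ []) → refl })

probe-computable : Computableⁿ 4 (λ σ t f v → probe (codeBit σ) t f v)
probe-computable = curry _
  (call₃ if0-computable (call₂ χ≤-computable (arg (# 1)) (arg (# 2)))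
    (call₃ if0-computable (call₂ codeBit-computable (arg (# 0)) (arg (# 2))) (lit 0)
      (call₃ if0-computable (call₂ χ≤-computable (arg (# 1)) (arg (# 3)))
        (call₂ +-computable (lit 2) (call₂ codeBit-computable (arg (# 0)) (arg (# 3))))
        (lit 1)))
    (lit 1))
  (λ { (σ ∷ t ∷ f ∷ v ∷ []) → refl })

search-computable : Computableⁿ 4 (λ σ t S q → search (codeBit σ) t S q)
search-computable = curry _
  (compose (firstNonZero-computable (callⁿ probe-computable (arg (# 1) ∷ arg (# 2) ∷ index 0 ∷ index 1 ∷ [])))
           (arg (# 1) ∷ arg (# 0) ∷ arg (# 1) ∷ arg (# 2) ∷ arg (# 3) ∷ []))
  (λ { (σ ∷ t ∷ S ∷ q ∷ []) → refl })
  where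
  index : ∀ b → Computable {5} (λ xs → codeIndex (fst (lookup xs (# 4))) (snd (lookup xs (# 4)))
                                                 (segmentCode (lookup xs (# 3)) (lookup xs (# 0))) b)
  index b = callⁿ codeIndex-computable
    (call₁ fst-computable (arg (# 4)) ∷ call₁ snd-computable (arg (# 4)) ∷
     call₂ segmentCode-computable (arg (# 3)) (arg (# 0)) ∷ lit b ∷ [])

nextEntry-computable : Computableⁿ 4 (λ σ t S q → nextEntry (codeBit σ) t S q)
nextEntry-computable = curry _
  (call₃ if0-computable (call₂ entry-computable (arg (# 2)) (arg (# 3)))
    (call₂ entryFromSearch-computable
      (callⁿ search-computable (arg (# 0) ∷ arg (# 1) ∷ arg (# 2) ∷ arg (# 3) ∷ [])) (arg (# 1)))
    (call₂ entry-computable (arg (# 2)) (arg (# 3))))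
  (λ { (σ ∷ t ∷ S ∷ q ∷ []) → refl })
  where
  entryFromSearch-computable : Computableⁿ 2 entryFromSearch
  entryFromSearch-computable = curry entryFromSearch
    (call₃ if0-computable (arg (# 0)) (lit 0)
      (call₃ if0-computable (call₁ pred-computable (arg (# 0))) (lit 0)
        (call₁ suc-computable (call₂ pair-computable (call₁ suc-computable (arg (# 1)))
                                                     (call₁ pred-computable (call₁ pred-computable (arg (# 0))))))))
    (λ { (r ∷ t ∷ []) → refl })

table-computable : Computableⁿ 2 (λ t σ → table (codeBit σ) t)
table-computable = recursionⁿ (λ t σ → table (codeBit σ) t) (lit 0)
  (compose (tabulateᶜ-computable
             (callⁿ nextEntry-computable (arg (# 3) ∷ arg (# 1) ∷ arg (# 2) ∷ arg (# 0) ∷ [])))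
           (call₁ suc-computable (arg (# 0)) ∷ arg (# 0) ∷ arg (# 1) ∷ arg (# 2) ∷ []))
  (λ { (σ ∷ []) → refl }) (λ { _ (σ ∷ []) → refl })

-- Bit ⟨⟨k, σ⟩, b⟩ runs the simulation on the segment coded by σ, for as many stages as σ is long.
realizerBit : ℕ → ℕ
realizerBit i = entryBit (tableEntry (codeBit (snd (fst i))) (codeLength (snd (fst i))) (fst (fst i)))
                         (codeLength (snd (fst i))) (snd i)

realizerBit-computable : Computableⁿ 1 realizerBit
realizerBit-computable = curry realizerBit
  (call₃ entryBit-computable
    (call₂ entry-computable (call₂ table-computable length σ)
                            (call₁ fst-computable (call₁ fst-computable (arg (# 0)))))
    length
    (call₁ snd-computable (arg (# 0))))
  (λ { (i ∷ []) → refl })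
  where
  σ : Computable {1} (λ xs → snd (fst (lookup xs (# 0))))
  σ = call₁ snd-computable (call₁ fst-computable (arg (# 0)))
  length : Computable {1} (λ xs → codeLength (snd (fst (lookup xs (# 0)))))
  length = call₁ codeLength-computable σ

realizer : Real
realizer i = nonZero (realizerBit i)

realizer-program : PR 1
realizer-program = program (call₁ sg-computable (uncurried realizerBit-computable))

realizer-computes : Computes realizer-program realizer
realizer-computes k = subst (Eval realizer-program (k ∷ [])) (sym (toBit-nonZero (realizerBit k)))
                            (evaluates (call₁ sg-computable (uncurried realizerBit-computable)) (k ∷ []))

evalT-renT : ∀ {n m} (r : Fin n → Fin m) {ρ : Vec ℕ n} {ρ′ : Vec ℕ m} →
             (∀ i → lookup ρ′ (r i) ≡ lookup ρ i) → ∀ t → evalT ρ′ (renT r t) ≡ evalT ρ t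
evalT-renT r agree (var i)  = agree i
evalT-renT r agree `0       = refl
evalT-renT r agree `1       = refl
evalT-renT r agree (s `+ t) = cong₂ _+_ (evalT-renT r agree s) (evalT-renT r agree t)
evalT-renT r agree (s `· t) = cong₂ _*_ (evalT-renT r agree s) (evalT-renT r agree t)

lift-agrees : ∀ {n m} (r : Fin n → Fin m) {ρ : Vec ℕ n} {ρ′ : Vec ℕ m} →
              (∀ i → lookup ρ′ (r i) ≡ lookup ρ i) →
              ∀ a i → lookup (a ∷ ρ′) (lift r i) ≡ lookup (a ∷ ρ) i
lift-agrees r agree a zero    = refl
lift-agrees r agree a (suc i) = agree i

Wit-ren : ∀ {n m} (r : Fin n → Fin m) {ρ : Vec ℕ n} {ρ′ : Vec ℕ m} →
          (∀ i → lookup ρ′ (r i) ≡ lookup ρ i) → ∀ A X → Wit (ren r A) ρ′ X ⇔ Wit A ρ X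
Wit-ren r agree (s `< t) X = mk⇔ (subst₂ _<_ (evalT-renT r agree s) (evalT-renT r agree t))
                                 (subst₂ _<_ (sym (evalT-renT r agree s)) (sym (evalT-renT r agree t)))
Wit-ren r agree (s `= t) X = mk⇔ (subst₂ _≡_ (evalT-renT r agree s) (evalT-renT r agree t))
                                 (subst₂ _≡_ (sym (evalT-renT r agree s)) (sym (evalT-renT r agree t)))
Wit-ren r agree (`¬ A) X = mk⇔ (λ ¬w (Y , w) → ¬w (Y , from (Wit-ren r agree A Y) w))
                               (λ ¬w (Y , w) → ¬w (Y , to (Wit-ren r agree A Y) w))
Wit-ren r agree (A `∧ B) X = mk⇔ (λ (a , b) → to (Wit-ren r agree A _) a , to (Wit-ren r agree B _) b)
                                 (λ (a , b) → from (Wit-ren r agree A _) a , from (Wit-ren r agree B _) b)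
Wit-ren r agree (A `∨ B) X =
  mk⇔ (⊎-map (map₂ (to (Wit-ren r agree A _))) (map₂ (to (Wit-ren r agree B _))))
      (⊎-map (map₂ (from (Wit-ren r agree A _))) (map₂ (from (Wit-ren r agree B _))))
Wit-ren r agree (A `⇒ B) W =
  mk⇔ (λ w Z a → map₂ (map₂ (to (Wit-ren r agree B _))) (w Z (from (Wit-ren r agree A Z) a)))
      (λ w Z a → map₂ (map₂ (from (Wit-ren r agree B _))) (w Z (to (Wit-ren r agree A Z) a)))
Wit-ren r agree (`∃ A) X =
  mk⇔ (λ (a , s , w) → a , s , to (Wit-ren (lift r) (lift-agrees r agree a) A _) w)
      (λ (a , s , w) → a , s , from (Wit-ren (lift r) (lift-agrees r agree a) A _) w)
Wit-ren r agree (`∀ A) X =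
  mk⇔ (λ w a → to (Wit-ren (lift r) (lift-agrees r agree a) A _) (w a))
      (λ w a → from (Wit-ren (lift r) (lift-agrees r agree a) A _) (w a))
Wit-ren r agree (`□ A) X =
  mk⇔ (λ (p , s , Z , c , w) → p , s , Z , c , to (Wit-ren r agree A Z) w)
      (λ (p , s , Z , c , w) → p , s , Z , c , from (Wit-ren r agree A Z) w)

Apply-respˡ : ∀ {W W′ Z Y} → W ≗ W′ → Apply W Z Y → Apply W′ Z Y
Apply-respˡ W≗W′ ap k with ap k
... | l , flag , earlier , value =
  l , trans (sym (W≗W′ _)) flag , (λ l′ l′<l → trans (sym (W≗W′ _)) (earlier l′ l′<l)) ,
  trans (sym (W≗W′ _)) value

Wit-resp : ∀ {n} (A : Fml n) {ρ : Vec ℕ n} {X X′ : Real} → X ≗ X′ → Wit A ρ X → Wit A ρ X′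
Wit-resp (s `< t) X≗X′ w = w
Wit-resp (s `= t) X≗X′ w = w
Wit-resp (`¬ A)   X≗X′ w = w
Wit-resp (A `∧ B) X≗X′ (a , b) =
  Wit-resp A (λ i → X≗X′ (pair 0 i)) a , Wit-resp B (λ i → X≗X′ (pair 1 i)) b
Wit-resp (A `∨ B) X≗X′ (inj₁ (c , a)) =
  inj₁ (trans (sym (X≗X′ _)) c , Wit-resp A (λ i → X≗X′ (pair 1 i)) a)
Wit-resp (A `∨ B) X≗X′ (inj₂ (c , b)) =
  inj₂ (trans (sym (X≗X′ _)) c , Wit-resp B (λ i → X≗X′ (pair 1 i)) b)
Wit-resp (A `⇒ B) W≗W′ w Z a = map₂ (map₁ (Apply-respˡ W≗W′)) (w Z a)
Wit-resp (`∃ A) X≗X′ (a , s , w) =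
  a , (λ i → trans (sym (X≗X′ _)) (s i)) , Wit-resp A (λ i → X≗X′ (pair 1 i)) w
Wit-resp (`∀ A) X≗X′ w a = Wit-resp A (λ i → X≗X′ (pair a i)) (w a)
Wit-resp (`□ A) X≗X′ (p , s , Z , c , w) = p , (λ i → trans (sym (X≗X′ i)) (s i)) , Z , c , w

OutputAt : Real → Real → ℕ → Bool → Set
OutputAt W Z k y = Σ ℕ λ l → flagW W k (initCode Z l) ≡ true ×
                             (∀ l′ → l′ < l → flagW W k (initCode Z l′) ≡ false) ×
                             valW W k (initCode Z l) ≡ y

output-from-entries : ∀ W Z k s v (E : ℕ → ℕ → ℕ) →
  (∀ l b → W (pair (pair k (initCode Z l)) b) ≡ nonZero (entryBit (E l b) l b)) →
  (∀ b → E s b ≡ suc (pair s v)) → (∀ l → E l 0 ≡ 0 ⊎ E l 0 ≡ suc (pair s v)) →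
  OutputAt W Z k (nonZero v)
output-from-entries W Z k s v E reads settled unsettled-or-settled = s , flag , earlier , value
  where
  flag : W (pair (pair k (initCode Z s)) 0) ≡ true
  flag = trans (reads s 0) (cong nonZero (trans (cong (λ e → entryBit e s 0) (settled 0)) (entryBit-flag s v)))
  earlier : ∀ l → l < s → W (pair (pair k (initCode Z l)) 0) ≡ false
  earlier l l<s with unsettled-or-settled l
  ... | inj₁ eq = trans (reads l 0) (cong (λ e → nonZero (entryBit e l 0)) eq)
  ... | inj₂ eq = trans (reads l 0) (cong nonZero (trans (cong (λ e → entryBit e l 0) eq)
                                                       (entryBit-unflagged s v l (<⇒≢ l<s))))
  value : W (pair (pair k (initCode Z s)) 1) ≡ nonZero v
  value = trans (reads s 1) (cong nonZero (trans (cong (λ e → entryBit e s 1) (settled 1)) (entryBit-value s v)))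

σ≤codeIndex : ∀ n k σ b → σ ≤ codeIndex n k σ b
σ≤codeIndex n k σ b =
  ≤-trans (snd≤pair k σ) (≤-trans (fst≤pair (pair k σ) b) (snd≤pair n (pair (pair k σ) b)))

realizerBit-pair : ∀ k σ b → realizerBit (pair (pair k σ) b) ≡
                             entryBit (tableEntry (codeBit σ) (codeLength σ) k) (codeLength σ) b
realizerBit-pair k σ b =
  cong (λ { ((k′ , σ′) , b′) →
             entryBit (tableEntry (codeBit σ′) (codeLength σ′) k′) (codeLength σ′) b′ })
       (cong₂ _,_ (cong₂ _,_ (trans (cong fst (fst-pair (pair k σ) b)) (fst-pair k σ))
                             (trans (cong snd (fst-pair (pair k σ) b)) (snd-pair k σ)))
                  (snd-pair (pair k σ) b))

realizer-initCode : ∀ X k l b → realizer (pair (pair k (initCode X l)) b) ≡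
                                nonZero (entryBit (tableEntry (λ i → toBit (X i)) l k) l b)
realizer-initCode X k l b =
  cong nonZero (trans (realizerBit-pair k (initCode X l) b)
                      (cong₂ (λ S L → entryBit (entry S k) L b) simulation-agrees (codeLength-initCode X l)))
  where
  simulation-agrees : table (codeBit (initCode X l)) (codeLength (initCode X l)) ≡ table (λ i → toBit (X i)) l
  simulation-agrees = trans (cong (table (codeBit (initCode X l))) (codeLength-initCode X l))
                            (table-cong l (codeBit-initCode X l))

module Construction (X : Real) where
  x : ℕ → ℕ
  x i = toBit (X i)

  V : Real
  V = simulatedV x

  Settled : ℕ → Real → Set
  Settled n Y = ∀ j → Σ ℕ λ s → tableEntry x s (pair n j) ≡ suc (pair s (toBit (Y j)))

  V-applies : ∀ m Y → Settled m Y → ∀ Z → Apply (comp V m) Z Y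
  V-applies m Y settled Z k =
    subst (OutputAt (comp V m) Z k) (nonZero-toBit (Y k))
          (output-from-entries (comp V m) Z k s (toBit (Y k)) E reads at
             (λ l → tableEntry-settled x (suc (codeIndex m k (initCode Z l) 0)) q s (toBit (Y k)) decided))
    where
    q s : ℕ
    q = pair m k
    s = proj₁ (settled k)
    decided : tableEntry x s q ≡ suc (pair s (toBit (Y k)))
    decided = proj₂ (settled k)
    E : ℕ → ℕ → ℕ
    E l b = tableEntry x (suc (codeIndex m k (initCode Z l) b)) q
    reads : ∀ l b → V (codeIndex m k (initCode Z l) b) ≡ nonZero (entryBit (E l b) l b)
    reads l b = cong nonZero (trans (simulatedBit-codeIndex _ m k (initCode Z l) b)
                                    (cong (λ L → entryBit (E l b) L b) (codeLength-initCode Z l)))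
    at : ∀ b → E s b ≡ suc (pair s (toBit (Y k)))
    at b = tableEntry-mono x q (pair s (toBit (Y k)))
             (m≤n⇒m≤1+n (≤-trans (initCode-≥ Z s) (σ≤codeIndex m k (initCode Z s) b))) decided

  module Settling (n j : ℕ) (y : Bool) (out : OutputAt (comp X n) V j y) where
    q l : ℕ
    q = pair n j
    l = proj₁ out

    index : ℕ → ℕ → ℕ
    index l′ b = codeIndex n j (initCode V l′) b

    x-flag : x (index l 0) ≡ 1
    x-flag = cong toBit (proj₁ (proj₂ out))

    x-earlier : ∀ l′ → l′ < l → x (index l′ 0) ≡ 0
    x-earlier l′ l′<l = cong toBit (proj₁ (proj₂ (proj₂ out)) l′ l′<l)

    x-value : x (index l 1) ≡ toBit y
    x-value = cong toBit (proj₂ (proj₂ (proj₂ out)))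

    searchTerm : ℕ → ℕ → ℕ
    searchTerm t l′ = probe x t (codeIndex (fst q) (snd q) (segmentCode (table x t) l′) 0)
                                (codeIndex (fst q) (snd q) (segmentCode (table x t) l′) 1)

    searchTerm-index : ∀ t l′ → l′ ≤ t → searchTerm t l′ ≡ probe x t (index l′ 0) (index l′ 1)
    searchTerm-index t l′ l′≤t =
      cong (λ { ((n′ , j′) , σ) → probe x t (codeIndex n′ j′ σ 0) (codeIndex n′ j′ σ 1) })
           (cong₂ _,_ (cong₂ _,_ (fst-pair n j) (snd-pair n j)) (segmentCode-table x t l′ l′≤t))

    -- Any successful search stops at segment length l, where X n first raises the flag for output j.
    search-sound : ∀ t w → search x t (table x t) q ≡ 2 + w → w ≡ toBit y
    search-sound t w found with firstNonZero-≡suc {searchTerm t} t (suc w) found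
    ... | l″ , l″<t , skipped , hit = by-position (<-cmp l″ l)
      where
      probed : probe x t (index l″ 0) (index l″ 1) ≡ 2 + w
      probed = trans (sym (searchTerm-index t l″ (<⇒≤ l″<t))) hit
      flagged : x (index l″ 0) ≢ 0
      flagged = proj₁ (proj₂ (probe-≡2+ x t (index l″ 0) (index l″ 1) w probed))
      read : w ≡ x (index l″ 1)
      read = proj₂ (proj₂ (probe-≡2+ x t (index l″ 0) (index l″ 1) w probed))
      by-position : Tri (l″ < l) (l″ ≡ l) (l″ > l) → w ≡ toBit y
      by-position (tri< l″<l _ _) = ⊥-elim (flagged (x-earlier l″ l″<l))
      by-position (tri≈ _ l″≡l _) = trans read (trans (cong (λ l′ → x (index l′ 1)) l″≡l) x-value)
      by-position (tri> _ _ l<l″) = ⊥-elim (0≢1+n (trans (sym unflagged) x-flag))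
        where
        unflagged : x (index l 0) ≡ 0
        unflagged = proj₂ (probe-≡0 x t (index l 0) (index l 1)
                            (trans (sym (searchTerm-index t l (<⇒≤ (<-trans l<l″ l″<t)))) (skipped l l<l″)))

    -- A stage late enough to see everything the search at segment length l consults.
    T : ℕ
    T = suc (q + (l + sum< (λ l′ → index l′ 0 + index l′ 1) (suc l)))

    <T : ∀ {a} → a ≤ sum< (λ l′ → index l′ 0 + index l′ 1) (suc l) → a < T
    <T a≤ = s≤s (≤-trans a≤ (≤-trans (m≤n+m _ l) (m≤n+m _ q)))

    l<T : l < T
    l<T = s≤s (≤-trans (m≤m+n l _) (m≤n+m _ q))

    search-complete : search x T (table x T) q ≡ 2 + toBit y
    search-complete = firstNonZero-at T l (suc (toBit y)) l<T skips hit
      where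
      flag<T : ∀ l′ → l′ ≤ l → index l′ 0 < T
      flag<T l′ l′≤l = <T (≤-trans (m≤m+n _ _) (term≤sum< _ (suc l) l′ (s≤s l′≤l)))
      skips : ∀ l′ → l′ < l → searchTerm T l′ ≡ 0
      skips l′ l′<l = trans (searchTerm-index T l′ (<⇒≤ (<-trans l′<l l<T)))
                            (probe-skip x T (index l′ 0) (index l′ 1)
                                        (flag<T l′ (<⇒≤ l′<l)) (x-earlier l′ l′<l))
      hit : searchTerm T l ≡ 2 + toBit y
      hit = trans (searchTerm-index T l (<⇒≤ l<T))
                  (trans (probe-hit x T (index l 0) (index l 1) (flag<T l ≤-refl) x-flag
                                    (<T (≤-trans (m≤n+m _ _) (term≤sum< _ (suc l) l ≤-refl))))
                         (cong (2 +_) x-value))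

    settled : Σ ℕ λ s → tableEntry x s q ≡ suc (pair s (toBit y))
    settled = by-entry-at-T (tableEntry x T q) refl
      where
      by-entry-at-T : ∀ e → tableEntry x T q ≡ e → Σ ℕ λ s → tableEntry x s q ≡ suc (pair s (toBit y))
      by-entry-at-T zero    eq = suc T , trans (tableEntry-suc x T q (m≤n⇒m≤1+n (s≤s (m≤m+n q _))))
                                               (cong₂ (λ e r → if0 e (entryFromSearch r T) e) eq search-complete)
      by-entry-at-T (suc e) eq =
        suc stage ,
        trans recorded (cong suc (trans encoded (cong (pair (suc stage)) (search-sound stage value found))))
        where open Origin (tableEntry-origin x T q e eq)

  settled-from-apply : ∀ n Y → Apply (comp X n) V Y → Settled n Y
  settled-from-apply n Y applies j = Settling.settled n j (Y j) (applies j)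

RealizesProgressive : Fml 1 → Fml 2 → Real → Set
RealizesProgressive P Prec X =
  ∀ n V →
  (∀ m Z → Wit Prec (m ∷ n ∷ []) Z → Σ Real λ Y → Apply (comp V m) Z Y × Wit P (m ∷ []) Y) →
  Σ Real λ Y → Apply (comp X n) V Y × Wit P (n ∷ []) Y

-- The embedding Fin 1 → Fin 2 used in TI is local to its definition; here it is found by unification.
realizesProgressive : ∀ {P Prec X} (e : Fin 1 → Fin 2) → e zero ≡ zero →
                      Wit (`∀ (`∀ (Prec `⇒ ren e P) `⇒ P)) [] X → RealizesProgressive P Prec X
realizesProgressive {P} e e-zero progressive n V below =
  progressive n V (λ m Z m≺n →
    map₂ (map₂ (from (Wit-ren e (λ { zero → cong (lookup (m ∷ n ∷ [])) e-zero }) P _))) (below m Z m≺n))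

module Solution (P : Fml 1) (Prec : Fml 2) (wf : WellFounded (DefRel Prec)) (X : Real)
                (progressive : RealizesProgressive P Prec X) where
  open Construction X

  solution : ∀ n → Acc (DefRel Prec) n → Σ Real λ Y → Settled n Y × Wit P (n ∷ []) Y
  solution n (acc below) = settle (progressive n V realized-below)
    where
    realized-below : ∀ m Z → Wit Prec (m ∷ n ∷ []) Z →
                     Σ Real λ Y → Apply (comp V m) Z Y × Wit P (m ∷ []) Y
    realized-below m Z m≺n =
      let Y , settled , realizes = solution m (below (Z , m≺n)) in Y , V-applies m Y settled Z , realizes
    settle : (Σ Real λ Y → Apply (comp X n) V Y × Wit P (n ∷ []) Y) →
             Σ Real λ Y → Settled n Y × Wit P (n ∷ []) Y
    settle (Y , applies , realizes) = Y , settled-from-apply n Y applies , realizes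

  Yₙ : ℕ → Real
  Yₙ n = proj₁ (solution n (wf n))

  Y : Real
  Y q = Yₙ (fst q) (snd q)

  Y-realizes : ∀ n → Wit P (n ∷ []) (comp Y n)
  Y-realizes n =
    Wit-resp P (λ j → sym (cong₂ Yₙ (fst-pair n j) (snd-pair n j))) (proj₂ (proj₂ (solution n (wf n))))

  realizer-applies : Apply realizer X Y
  realizer-applies k = subst (OutputAt realizer X k) (nonZero-toBit (Y k))
    (output-from-entries realizer X k s (toBit (Y k)) (λ l b → tableEntry x l k) (realizer-initCode X k)
                         (λ b → decided) (λ l → tableEntry-settled x l k s (toBit (Y k)) decided))
    where
    settled : Σ ℕ λ s → tableEntry x s (pair (fst k) (snd k)) ≡ suc (pair s (toBit (Y k)))
    settled = proj₁ (proj₂ (solution (fst k) (wf (fst k)))) (snd k)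
    s : ℕ
    s = proj₁ settled
    decided : tableEntry x s k ≡ suc (pair s (toBit (Y k)))
    decided = subst (λ k′ → tableEntry x s k′ ≡ suc (pair s (toBit (Y k)))) (pair-fst-snd k) (proj₂ settled)

proposition2 : (P : Fml 1) (Prec : Fml 2) →
    WellFounded (DefRel Prec) →
    ConstructivelyTrue (TI P Prec)
proposition2 P Prec wf = realizer-program , realizer , realizer-computes , λ X progressive →
  let open Solution P Prec wf X (realizesProgressive {X = X} _ refl progressive) in Y , realizer-applies , Y-realizes
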